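{- Extend the standard model of arithmetic to an $\mathcal L_{\mathsf{ID}}^\Omega$-structure $\mathcal N$ by recursion on $\delta\preceq\Omega$: $I^{\prec\delta,\mathcal N}_\varphi:=\bigcup_{\gamma\prec\delta}I^{\gamma,\mathcal N}_\varphi$ with $I^{\gamma,\mathcal N}_\varphi:=\{n\in\mathbb N\mid\mathcal N\vDash\varphi(n,I^{\prec\gamma,\mathcal N}_\varphi)\}$. If $\mathcal H$ is a nice operator and $\mathcal H\vdash^\alpha_\rho\Gamma$ with $\alpha\prec\Omega$, then $\mathcal N\vDash\bigvee\Gamma$.
   Context: Ordinal terms: The set $\vartheta(\varepsilon_{\Omega+1})$ of terms, a relation $\prec$ and finite sets $E(\alpha)$ are defined by simultaneous recursion on term length: Terms: $\Omega$; $\vartheta\alpha$ for each term $\alpha$; $\langle\alpha_0,\dots,\alpha_{n-1}\rangle$ ($n\ge0$) provided that if $n>1$ then $\alpha_{n-1}\preceq\dots\preceq\alpha_0$ ($\preceq$ is $\prec$ or syntactic equality), and if $n=1$ then $\alpha_0$ is not $\Omega$ or of the form $\vartheta\beta$. $E(\Omega)=\emptyset$, $E(\vartheta\alpha)=\{\vartheta\alpha\}$, $E(\langle\alpha_0,\dots\rangle)=\bigcup_iE(\alpha_i)$. $\alpha\prec\beta$ iff: (1) $\alpha=\Omega$, $\beta=\langle\beta_0,\dots,\beta_{n-1}\rangle$, $n>0$, $\Omega\preceq\beta_0$; or (2) $\alpha=\vartheta\alpha'$ and either $\beta=\Omega$, or $\beta=\langle\beta_0,\dots\rangle$ nonempty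 with $\alpha\preceq\beta_0$, or $\beta=\vartheta\beta'$ with $\alpha'\prec\beta'$ and $\gamma\prec\beta$ for all $\gamma\in E(\alpha')$, or $\beta=\vartheta\beta'$ with $\alpha\preceq\gamma$ for some $\gamma\in E(\beta')$; or (3) $\alpha=\langle\alpha_0,\dots,\alpha_{m-1}\rangle$ and either $\beta\in\{\Omega\}\cup\{\vartheta\beta'\}$ with ($m=0$ or $\alpha_0\prec\beta$), or $\beta=\langle\beta_0,\dots,\beta_{n-1}\rangle$ is lexicographically larger ($\alpha$ a proper initial segment of $\beta$, or first difference $\alpha_j\prec\beta_j$). This is a well-founded linear order. Numerals: $n:=\langle0,\dots,0\rangle$ ($n$ entries, $0=\langle\rangle$), $\omega:=\langle 1\rangle$. Addition: identify $\Omega,\vartheta\alpha$ with $\langle\Omega\rangle,\langle\vartheta\alpha\rangle$ and set $\langle\alpha_0,\dots,\alpha_{m-1}\rangle+\langle\beta_0,\dots,\beta_{n-1}\rangle=\langle\alpha_0,\dots,\alpha_{k-1},\beta_0,\dots,\beta_{n-1}\rangle$ where $k$ is largest such that $\beta_0\preceq\alpha_{k-1}$ (all of $\alpha$ if $n=0$; $k=0$ if no such); $\omega\cdot\Omega=\Omega$, $\omega\cdot\vartheta\alpha=\vartheta\alpha$, $\omega\cdot\langle\alpha_0,\dots\rangle=\langle1+\alpha_0,\dots\rangle$. Language: formulas are in negation normal form. An operator form is a formula $\varphi(x,X)$ of arithmetic with an extra unary predicate $X$, with one free number variable and no subformula $\neg Xt$. $\mathcal L^\Omega_{\mathsf{ID}}$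 extends $\mathcal L_{\mathsf{PA}}$ by predicates $I^{\prec\alpha}_\varphi$ for each operator form $\varphi$ and term $\alpha\preceq\Omega$; $\varphi(t,I^{\prec\gamma}_\varphi)$ replaces $x$ by $t$ and $Xs$ by $I^{\prec\gamma}_\varphi s$. Each sentence is assigned a disjunction or conjunction: a false $\mathcal L_{\mathsf{PA}}$-literal $\simeq$ empty disjunction; $I^{\prec\alpha}_\varphi t\simeq\bigvee_{\gamma\prec\alpha}\varphi(t,I^{\prec\gamma}_\varphi)$; $\psi_0\lor\psi_1\simeq\bigvee_{i\prec2}\psi_i$; $\exists x\,\psi(x)\simeq\bigvee_{n\prec\omega}\psi(n)$; and $\neg\psi\simeq\bigwedge_{\gamma\prec\alpha}\neg\psi_\gamma$ whenever $\psi\simeq\bigvee_{\gamma\prec\alpha}\psi_\gamma$. Ranks: $\operatorname{rk}=0$ for $\mathcal L_{\mathsf{PA}}$-literals, $\operatorname{rk}(\pm I^{\prec\alpha}_\varphi t)=\omega\cdot\alpha$, $\operatorname{rk}(\psi_0\lor\psi_1)=\operatorname{rk}(\psi_0\land\psi_1)=\max(\operatorname{rk}\psi_0,\operatorname{rk}\psi_1)+1$, $\operatorname{rk}(\exists x\psi)=\operatorname{rk}(\forall x\psi)=\operatorname{rk}(\psi)+1$. $k(\psi)$ is the set of $\alpha$ such that $\psi$ contains a literal $I^{\prec\alpha}_\varphi t$ or $\neg I^{\prec\alpha}_\varphi t$; for a sequent (finite set of sentences) $k(\Gamma)=\bigcup_{\psi\in\Gamma}k(\psi)$; $\bigvee\Gamma$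 is the disjunction of its members. Operators: with $\mathcal P$ the powerset of $\vartheta(\varepsilon_{\Omega+1})$, a nice operator is $\mathcal H:\mathcal P\to\mathcal P$ with $X\subseteq\mathcal H(X)$, ($X\subseteq\mathcal H(Y)\Rightarrow\mathcal H(X)\subseteq\mathcal H(Y)$), and ($\alpha\in\mathcal H(X)\Leftrightarrow E(\alpha)\subseteq\mathcal H(X)$); $\mathcal H[Z](X):=\mathcal H(Z\cup X)$. Derivations: $\mathcal H\vdash^\alpha_\rho\Gamma$ is defined by recursion on $\alpha$: it holds iff $\{\alpha\}\cup k(\Gamma)\subseteq\mathcal H(\emptyset)$ and one of: ($\bigwedge$) some $\psi\simeq\bigwedge_{\gamma\prec\delta}\psi_\gamma$ in $\Gamma$ such that for every $\gamma\prec\delta$ there is $\alpha(\gamma)\prec\alpha$ with $\mathcal H[\{\gamma\}]\vdash^{\alpha(\gamma)}_\rho\Gamma\cup\{\psi_\gamma\}$; ($\bigvee$) some $\psi\simeq\bigvee_{\gamma\prec\delta}\psi_\gamma$ in $\Gamma$, some $\gamma\prec\delta$ with $\gamma\prec\alpha$ and $\gamma\in\mathcal H(\emptyset)$, and $\alpha'\prec\alpha$ with $\mathcal H\vdash^{\alpha'}_\rho\Gamma\cup\{\psi_\gamma\}$; (Cut) some sentence $\psi$ with $\operatorname{rk}(\psi)\prec\rho$ and $\alpha'\prec\alpha$ with $\mathcal H\vdash^{\alpha'}_\rho\Gamma\cup\{\psi\}$ and $\mathcal H\vdash^{\alpha'}_\rho\Gamma\cup\{\neg\psi\}$; (Fix)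 $\Omega\preceq\alpha$, some $I^{\prec\Omega}_\varphi t\in\Gamma$ and $\alpha'\prec\alpha$ with $\mathcal H\vdash^{\alpha'}_\rho\Gamma\cup\{\varphi(t,I^{\prec\Omega}_\varphi)\}$. -}

module Defs where

open import Level using (0ℓ)
open import Data.Nat using (ℕ; zero; suc) renaming (_+_ to _+ℕ_; _*_ to _*ℕ_)
import Data.Nat as Nat
open import Data.Fin using (Fin; zero; suc)
open import Data.List using (List; []; _∷_; _++_; _∷ʳ_; length)
open import Data.List.Relation.Unary.All using (All; []; _∷_)
open import Data.List.Relation.Unary.Any using (Any)
open import Data.List.Membership.Propositional using () renaming (_∈_ to _∈L_)
open import Data.Product using (Σ; Σ-syntax; _×_; _,_)
open import Data.Sum using (_⊎_; inj₁; inj₂)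
open import Data.Unit using (⊤; tt)
open import Data.Empty using (⊥; ⊥-elim)
open import Data.Bool using (if_then_else_)
open import Relation.Nullary using (¬_; does)
open import Relation.Binary.PropositionalEquality using (_≡_; refl)
open import Relation.Unary using (Pred)
import Relation.Unary as U

data Tm : Set where
  Ω   : Tm
  ϑ   : Tm → Tm
  ⟨_⟩ : List Tm → Tm

mutual
  E : Tm → List Tm
  E Ω       = []
  E (ϑ a)   = ϑ a ∷ []
  E ⟨ as ⟩  = Es as

  Es : List Tm → List Tm
  Es []       = []
  Es (a ∷ as) = E a ++ Es as

mutual
  data _≺_ : Tm → Tm → Set where
    Ω≺tup  : ∀ {b bs} → Ω ⪯ b → Ω ≺ ⟨ b ∷ bs ⟩
    ϑ≺Ω    : ∀ {a} → ϑ a ≺ Ω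
    ϑ≺tup  : ∀ {a b bs} → ϑ a ⪯ b → ϑ a ≺ ⟨ b ∷ bs ⟩
    ϑ≺ϑ₁   : ∀ {a b} → a ≺ b → All (λ g → g ≺ ϑ b) (E a) → ϑ a ≺ ϑ b
    ϑ≺ϑ₂   : ∀ {a b} → Any (λ g → ϑ a ⪯ g) (E b) → ϑ a ≺ ϑ b
    []≺Ω   : ⟨ [] ⟩ ≺ Ω
    []≺ϑ   : ∀ {b} → ⟨ [] ⟩ ≺ ϑ b
    tup≺Ω  : ∀ {a as} → a ≺ Ω → ⟨ a ∷ as ⟩ ≺ Ω
    tup≺ϑ  : ∀ {a as b} → a ≺ ϑ b → ⟨ a ∷ as ⟩ ≺ ϑ b
    tup≺tup : ∀ {as bs} → Lex as bs → ⟨ as ⟩ ≺ ⟨ bs ⟩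

  data _⪯_ : Tm → Tm → Set where
    lt : ∀ {a b} → a ≺ b → a ⪯ b
    eq : ∀ {a} → a ⪯ a

  data Lex : List Tm → List Tm → Set where
    prefix : ∀ {b bs} → Lex [] (b ∷ bs)
    here   : ∀ {a as b bs} → a ≺ b → Lex (a ∷ as) (b ∷ bs)
    there  : ∀ {x as bs} → Lex as bs → Lex (x ∷ as) (x ∷ bs)

data Desc : List Tm → Set where
  d[] : Desc []
  d1  : ∀ {a} → Desc (a ∷ [])
  d∷  : ∀ {a b cs} → b ⪯ a → Desc (b ∷ cs) → Desc (a ∷ b ∷ cs)

IsTup : Tm → Set
IsTup ⟨ _ ⟩ = ⊤
IsTup Ω     = ⊥
IsTup (ϑ _) = ⊥

SingOK : List Tm → Set
SingOK []           = ⊤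
SingOK (a ∷ [])     = IsTup a
SingOK (_ ∷ _ ∷ _)  = ⊤

data WF : Tm → Set where
  wfΩ   : WF Ω
  wfϑ   : ∀ {a} → WF a → WF (ϑ a)
  wftup : ∀ {as} → All WF as → Desc as → SingOK as → WF ⟨ as ⟩

record Term : Set where
  constructor term
  field
    tm : Tm
    wf : WF tm
open Term public

_≺ₜ_ : Term → Term → Set
a ≺ₜ b = tm a ≺ tm b

mutual
  Ew : ∀ {a} → WF a → List Term
  Ew wfΩ             = []
  Ew (wfϑ {a} w)     = term (ϑ a) (wfϑ w) ∷ []
  Ew (wftup ws _ _)  = Ews ws

  Ews : ∀ {as} → All WF as → List Term
  Ews []       = []
  Ews (w ∷ ws) = Ew w ++ Ews ws

Eₜ : Term → List Term
Eₜ a = Ew (wf a)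

zeroTm oneTm : Tm
zeroTm = ⟨ [] ⟩
oneTm  = ⟨ zeroTm ∷ [] ⟩

wf0 : WF zeroTm
wf0 = wftup [] d[] tt

wf1 : WF oneTm
wf1 = wftup (wf0 ∷ []) d1 tt

zeroT twoT ωT : Term
zeroT = term zeroTm wf0
twoT  = term ⟨ zeroTm ∷ zeroTm ∷ [] ⟩ (wftup (wf0 ∷ wf0 ∷ []) (d∷ eq d1) tt)
ωT    = term ⟨ oneTm ∷ [] ⟩ (wftup (wf1 ∷ []) d1 tt)

-- a term γ ≺ ω is a numeral ⟨0,…,0⟩; this reads off its value
toNat : Tm → ℕ
toNat ⟨ xs ⟩ = length xs
toNat Ω      = 0
toNat (ϑ _)  = 0

-- identify Ω, ϑα with ⟨Ω⟩, ⟨ϑα⟩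
toL : Tm → List Tm
toL Ω       = Ω ∷ []
toL (ϑ a)   = ϑ a ∷ []
toL ⟨ xs ⟩  = xs

fromL : List Tm → Tm
fromL []                = ⟨ [] ⟩
fromL (Ω ∷ [])          = Ω
fromL (ϑ a ∷ [])        = ϑ a
fromL (⟨ ys ⟩ ∷ [])     = ⟨ ⟨ ys ⟩ ∷ [] ⟩
fromL (x ∷ y ∷ zs)      = ⟨ x ∷ y ∷ zs ⟩

LastOK : Tm → List Tm → Set
LastOK b0 xs = (xs ≡ []) ⊎ (Σ[ zs ∈ List Tm ] Σ[ x ∈ Tm ] (xs ≡ zs ∷ʳ x × b0 ⪯ x))

-- Add α β γ  :⇔  α + β = γ ;  k is the length of xs, and all later
-- entries ys fail β₀ ⪯ α_j, so k is the largest such index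
data Add : Tm → Tm → Tm → Set where
  add0 : ∀ {a b} → toL b ≡ [] → Add a b a
  addS : ∀ {a b b0 bs xs ys} → toL b ≡ b0 ∷ bs → toL a ≡ xs ++ ys →
         LastOK b0 xs → All (λ y → ¬ (b0 ⪯ y)) ys →
         Add a b (fromL (xs ++ toL b))

data OmegaMul : Tm → Tm → Set where
  ωΩ   : OmegaMul Ω Ω
  ωϑ   : ∀ {a} → OmegaMul (ϑ a) (ϑ a)
  ω[]  : OmegaMul ⟨ [] ⟩ ⟨ [] ⟩
  ωtup : ∀ {a0 as c} → Add oneTm a0 c → OmegaMul ⟨ a0 ∷ as ⟩ ⟨ c ∷ as ⟩

data Max : Tm → Tm → Tm → Set where
  maxR : ∀ {a b} → a ⪯ b → Max a b b
  maxL : ∀ {a b} → b ≺ a → Max a b a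

noΩ : ∀ {x} → Ω ⪯ x → x ≺ Ω → ⊥
noΩ eq ()
noΩ (lt (Ω≺tup p)) (tup≺Ω q) = noΩ p q

below≺ : ∀ {g a} → g ≺ a → a ≺ Ω → g ≺ Ω
below≺ (Ω≺tup p) (tup≺Ω q) = ⊥-elim (noΩ p q)
below≺ ϑ≺Ω ()
below≺ (ϑ≺tup _) _ = ϑ≺Ω
below≺ (ϑ≺ϑ₁ _ _) _ = ϑ≺Ω
below≺ (ϑ≺ϑ₂ _) _ = ϑ≺Ω
below≺ []≺Ω ()
below≺ []≺ϑ _ = []≺Ω
below≺ (tup≺Ω _) ()
below≺ (tup≺ϑ p) _ = tup≺Ω (below≺ p ϑ≺Ω)
below≺ (tup≺tup prefix) _ = []≺Ω
below≺ (tup≺tup (here p)) (tup≺Ω q) = tup≺Ω (below≺ p q)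
below≺ (tup≺tup (there _)) (tup≺Ω q) = tup≺Ω q

below : ∀ {g a} → g ≺ a → a ⪯ Ω → g ⪯ Ω
below p eq     = lt p
below p (lt q) = lt (below≺ p q)

data ATm (n : ℕ) : Set where
  var  : Fin n → ATm n
  zer  : ATm n
  S    : ATm n → ATm n
  _⊕_  : ATm n → ATm n → ATm n
  _⊗_  : ATm n → ATm n → ATm n

-- formulas in negation normal form with n free number variables,
-- positive atoms labelled by P and negated atoms labelled by N
data Fm (P N : Set) (n : ℕ) : Set where
  equ  : ATm n → ATm n → Fm P N n
  neq  : ATm n → ATm n → Fm P N n
  pos  : P → ATm n → Fm P N n
  neg  : N → ATm n → Fm P N n
  _∨'_ : Fm P N n → Fm P N n → Fm P N n
  _∧'_ : Fm P N n → Fm P N n → Fm P N n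
  ex   : Fm P N (suc n) → Fm P N n
  all  : Fm P N (suc n) → Fm P N n

-- operator forms φ(x,X): one free variable x, atoms X t only positively
OpForm : Set
OpForm = Fm ⊤ ⊥ 1

-- the predicate symbols I^{≺α}_φ of L^Ω_ID, α ⪯ Ω
record IP : Set where
  constructor I
  field
    lvl   : Term
    lvl⪯Ω : tm lvl ⪯ Ω
    form  : OpForm
open IP public

LFm : ℕ → Set
LFm = Fm IP IP

Sentence : Set
Sentence = LFm 0

renT : ∀ {n m} → (Fin n → Fin m) → ATm n → ATm m
renT r (var i) = var (r i)
renT r zer     = zer
renT r (S t)   = S (renT r t)
renT r (s ⊕ t) = renT r s ⊕ renT r t
renT r (s ⊗ t) = renT r s ⊗ renT r t

subT : ∀ {n m} → (Fin n → ATm m) → ATm n → ATm m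
subT σ (var i) = σ i
subT σ zer     = zer
subT σ (S t)   = S (subT σ t)
subT σ (s ⊕ t) = subT σ s ⊕ subT σ t
subT σ (s ⊗ t) = subT σ s ⊗ subT σ t

liftS : ∀ {n m} → (Fin n → ATm m) → Fin (suc n) → ATm (suc m)
liftS σ zero    = var zero
liftS σ (suc i) = renT suc (σ i)

subF : ∀ {P N P' N' n m} → (P → P') → (N → N') → (Fin n → ATm m) →
       Fm P N n → Fm P' N' m
subF f g σ (equ s t) = equ (subT σ s) (subT σ t)
subF f g σ (neq s t) = neq (subT σ s) (subT σ t)
subF f g σ (pos p t) = pos (f p) (subT σ t)
subF f g σ (neg p t) = neg (g p) (subT σ t)
subF f g σ (a ∨' b)  = subF f g σ a ∨' subF f g σ b
subF f g σ (a ∧' b)  = subF f g σ a ∧' subF f g σ b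
subF f g σ (ex a)    = ex (subF f g (liftS σ) a)
subF f g σ (all a)   = all (subF f g (liftS σ) a)

num : ∀ {n} → ℕ → ATm n
num zero    = zer
num (suc k) = S (num k)

inst : OpForm → ATm 0 → IP → Sentence
inst φ t p = subF (λ _ → p) ⊥-elim (λ _ → t) φ

inst0 : LFm 1 → ℕ → Sentence
inst0 ψ k = subF (λ p → p) (λ p → p) (λ _ → num k) ψ

negate : ∀ {n} → LFm n → LFm n
negate (equ s t) = neq s t
negate (neq s t) = equ s t
negate (pos p t) = neg p t
negate (neg p t) = pos p t
negate (a ∨' b)  = negate a ∧' negate b
negate (a ∧' b)  = negate a ∨' negate b
negate (ex a)    = all (negate a)
negate (all a)   = ex (negate a)

eval : ∀ {n} → ATm n → (Fin n → ℕ) → ℕ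
eval (var i) e = e i
eval zer e     = 0
eval (S t) e   = suc (eval t e)
eval (s ⊕ t) e = eval s e +ℕ eval t e
eval (s ⊗ t) e = eval s e *ℕ eval t e

ev : ATm 0 → ℕ
ev t = eval t (λ ())

data Kind : Set where
  disj conj : Kind

kind : Sentence → Kind
kind (equ s t) = if does (ev s Nat.≟ ev t) then conj else disj
kind (neq s t) = if does (ev s Nat.≟ ev t) then disj else conj
kind (pos _ _) = disj
kind (neg _ _) = conj
kind (_ ∨' _)  = disj
kind (_ ∧' _)  = conj
kind (ex _)    = disj
kind (all _)   = conj

bound : Sentence → Term
bound (equ _ _) = zeroT
bound (neq _ _) = zeroT
bound (pos p _) = lvl p
bound (neg p _) = lvl p
bound (_ ∨' _)  = twoT
bound (_ ∧' _)  = twoT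
bound (ex _)    = ωT
bound (all _)   = ωT

pick : Sentence → Sentence → ℕ → Sentence
pick a b zero    = a
pick a b (suc _) = b

comp : (ψ : Sentence) (γ : Term) → γ ≺ₜ bound ψ → Sentence
comp (equ s t) γ _ = equ s t        -- vacuous: nothing is ≺ 0
comp (neq s t) γ _ = neq s t
comp (pos p t) γ q = inst (form p) t (I γ (below q (lvl⪯Ω p)) (form p))
comp (neg p t) γ q = negate (inst (form p) t (I γ (below q (lvl⪯Ω p)) (form p)))
comp (a ∨' b)  γ _ = pick a b (toNat (tm γ))
comp (a ∧' b)  γ _ = pick a b (toNat (tm γ))
comp (ex a)    γ _ = inst0 a (toNat (tm γ))
comp (all a)   γ _ = inst0 a (toNat (tm γ))

data Rank : ∀ {n} → LFm n → Tm → Set where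
  rk-equ : ∀ {n} {s t : ATm n} → Rank (equ s t) zeroTm
  rk-neq : ∀ {n} {s t : ATm n} → Rank (neq s t) zeroTm
  rk-pos : ∀ {n} {p} {t : ATm n} {r} → OmegaMul (tm (lvl p)) r → Rank (pos p t) r
  rk-neg : ∀ {n} {p} {t : ATm n} {r} → OmegaMul (tm (lvl p)) r → Rank (neg p t) r
  rk-∨   : ∀ {n} {a b : LFm n} {r0 r1 m r} → Rank a r0 → Rank b r1 →
           Max r0 r1 m → Add m oneTm r → Rank (a ∨' b) r
  rk-∧   : ∀ {n} {a b : LFm n} {r0 r1 m r} → Rank a r0 → Rank b r1 →
           Max r0 r1 m → Add m oneTm r → Rank (a ∧' b) r
  rk-ex  : ∀ {n} {a : LFm (suc n)} {r0 r} → Rank a r0 → Add r0 oneTm r → Rank (ex a) r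
  rk-all : ∀ {n} {a : LFm (suc n)} {r0 r} → Rank a r0 → Add r0 oneTm r → Rank (all a) r

kF : ∀ {n} → LFm n → List Term
kF (equ _ _) = []
kF (neq _ _) = []
kF (pos p _) = lvl p ∷ []
kF (neg p _) = lvl p ∷ []
kF (a ∨' b)  = kF a ++ kF b
kF (a ∧' b)  = kF a ++ kF b
kF (ex a)    = kF a
kF (all a)   = kF a

Op : Set₁
Op = Pred Term 0ℓ → Pred Term 0ℓ

record Nice (H : Op) : Set₁ where
  field
    incl  : ∀ X → X U.⊆ H X
    trans : ∀ X Y → X U.⊆ H Y → H X U.⊆ H Y
    Ecl   : ∀ X α → (α U.∈ H X → (∀ {β} → β ∈L Eₜ α → β U.∈ H X))
                  × ((∀ {β} → β ∈L Eₜ α → β U.∈ H X) → α U.∈ H X)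

_[_] : Op → Pred Term 0ℓ → Op
(H [ Z ]) X = H (Z U.∪ X)

Side : Op → Term → List Sentence → Set
Side H α Γ = (α U.∈ H U.∅) × (∀ {ψ} → ψ ∈L Γ → ∀ {β} → β ∈L kF ψ → β U.∈ H U.∅)

data Der : Op → Term → Term → List Sentence → Set₁ where
  ⋀-rule : ∀ {H α ρ Γ} → Side H α Γ →
           (ψ : Sentence) → ψ ∈L Γ → kind ψ ≡ conj →
           ((γ : Term) (q : γ ≺ₜ bound ψ) →
              Σ[ α' ∈ Term ] (α' ≺ₜ α × Der (H [ U.｛ γ ｝ ]) α' ρ (comp ψ γ q ∷ Γ))) →
           Der H α ρ Γ
  ⋁-rule : ∀ {H α ρ Γ} → Side H α Γ →
           (ψ : Sentence) → ψ ∈L Γ → kind ψ ≡ disj →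
           (γ : Term) (q : γ ≺ₜ bound ψ) → γ ≺ₜ α → γ U.∈ H U.∅ →
           (α' : Term) → α' ≺ₜ α → Der H α' ρ (comp ψ γ q ∷ Γ) →
           Der H α ρ Γ
  cut    : ∀ {H α ρ Γ} → Side H α Γ →
           (ψ : Sentence) (r : Tm) → Rank ψ r → r ≺ tm ρ →
           (α' : Term) → α' ≺ₜ α →
           Der H α' ρ (ψ ∷ Γ) → Der H α' ρ (negate ψ ∷ Γ) →
           Der H α ρ Γ
  fix    : ∀ {H α ρ Γ} → Side H α Γ → Ω ⪯ tm α →
           (p : IP) → tm (lvl p) ≡ Ω → (t : ATm 0) → pos p t ∈L Γ →
           (α' : Term) → α' ≺ₜ α → Der H α' ρ (inst (form p) t p ∷ Γ) →
           Der H α ρ Γ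

ext : ∀ {n} → ℕ → (Fin n → ℕ) → Fin (suc n) → ℕ
ext k e zero    = k
ext k e (suc i) = e i

SatOF : ∀ {n} → (ℕ → Set) → Fm ⊤ ⊥ n → (Fin n → ℕ) → Set
SatOF P (equ s t) e = eval s e ≡ eval t e
SatOF P (neq s t) e = ¬ (eval s e ≡ eval t e)
SatOF P (pos _ t) e = P (eval t e)
SatOF P (neg () t) e
SatOF P (a ∨' b) e  = SatOF P a e ⊎ SatOF P b e
SatOF P (a ∧' b) e  = SatOF P a e × SatOF P b e
SatOF P (ex a) e    = Σ[ k ∈ ℕ ] SatOF P a (ext k e)
SatOF P (all a) e   = (k : ℕ) → SatOF P a (ext k e)

-- n ∈ I^{≺δ,𝒩}_φ  iff  n ∈ I^{γ,𝒩}_φ for some γ ≺ δ,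
-- where I^{γ,𝒩}_φ = {n | 𝒩 ⊨ φ(n, I^{≺γ,𝒩}_φ)}
data Mem (φ : OpForm) : Tm → ℕ → Set where
  mem : ∀ {δ n} (γ : Term) → tm γ ≺ δ → SatOF (Mem φ (tm γ)) φ (λ _ → n) → Mem φ δ n

Sat : ∀ {n} → LFm n → (Fin n → ℕ) → Set
Sat (equ s t) e = eval s e ≡ eval t e
Sat (neq s t) e = ¬ (eval s e ≡ eval t e)
Sat (pos p t) e = Mem (form p) (tm (lvl p)) (eval t e)
Sat (neg p t) e = ¬ Mem (form p) (tm (lvl p)) (eval t e)
Sat (a ∨' b) e  = Sat a e ⊎ Sat b e
Sat (a ∧' b) e  = Sat a e × Sat b e
Sat (ex a) e    = Σ[ k ∈ ℕ ] Sat a (ext k e)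
Sat (all a) e   = (k : ℕ) → Sat a (ext k e)

⊨⋁ : List Sentence → Set
⊨⋁ Γ = Any (λ ψ → Sat ψ (λ ())) Γ

{-# OPTIONS --safe #-}
module Submission where

-- Since α ≺ Ω, every subderivation again has height below Ω, so the rule
-- (Fix), the only rule sensitive to the fixed point I^{≺Ω}, never occurs.
-- The remaining rules are sound in 𝒩 because 𝒩 ⊨ ψ holds exactly when
-- 𝒩 ⊨ ψ_γ for some γ ≺ δ (ψ ≃ ⋁_{γ≺δ} ψ_γ), respectively for all γ ≺ δ
-- (ψ ≃ ⋀_{γ≺δ} ψ_γ); for I^{≺α}_φ t this is the defining recursion of 𝒩.

open import Defs
open import Level using (0ℓ)
open import Axiom.ExcludedMiddle using (ExcludedMiddle)
open import Data.Bool using (if_then_else_)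
open import Data.Empty using (⊥; ⊥-elim)
open import Data.Fin using (Fin; zero; suc)
open import Data.List using (List; []; _∷_; replicate)
open import Data.List.Properties using (length-replicate)
open import Data.List.Membership.Propositional using (_∈_; lose)
open import Data.List.Relation.Unary.All using (All; []; _∷_)
open import Data.List.Relation.Unary.Any using (here; there)
open import Data.Nat using (ℕ; zero; suc; _+_; _*_; _≟_)
open import Data.Product as Product using (Σ; _,_)
open import Data.Sum as Sum using (_⊎_; inj₁; inj₂; [_,_]′)
open import Data.Sum.Function.Propositional using (_⊎-⇔_)
open import Data.Product.Function.NonDependent.Propositional using (_×-⇔_)
open import Data.Unit using (⊤; tt)
open import Function using (_∘_; id; _⇔_; mk⇔; Equivalence)
open import Function.Construct.Identity using (⇔-id)
open import Relation.Nullary using (¬_; Dec; yes; no; does)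
open import Relation.Binary.PropositionalEquality using (_≡_; refl; sym; trans; cong; cong₂; _≗_)

open Equivalence using (to; from)

eval-cong : ∀ {n} (t : ATm n) {e e' : Fin n → ℕ} → e ≗ e' → eval t e ≡ eval t e'
eval-cong (var i) e≗e' = e≗e' i
eval-cong zer     e≗e' = refl
eval-cong (S t)   e≗e' = cong suc (eval-cong t e≗e')
eval-cong (s ⊕ t) e≗e' = cong₂ _+_ (eval-cong s e≗e') (eval-cong t e≗e')
eval-cong (s ⊗ t) e≗e' = cong₂ _*_ (eval-cong s e≗e') (eval-cong t e≗e')

eval-renT : ∀ {n m} (r : Fin n → Fin m) (t : ATm n) {e : Fin m → ℕ} {e' : Fin n → ℕ} →
            e ∘ r ≗ e' → eval (renT r t) e ≡ eval t e'
eval-renT r (var i) e∘r≗e' = e∘r≗e' i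
eval-renT r zer     e∘r≗e' = refl
eval-renT r (S t)   e∘r≗e' = cong suc (eval-renT r t e∘r≗e')
eval-renT r (s ⊕ t) e∘r≗e' = cong₂ _+_ (eval-renT r s e∘r≗e') (eval-renT r t e∘r≗e')
eval-renT r (s ⊗ t) e∘r≗e' = cong₂ _*_ (eval-renT r s e∘r≗e') (eval-renT r t e∘r≗e')

eval-subT : ∀ {n m} (σ : Fin n → ATm m) (t : ATm n) {e : Fin m → ℕ} {e' : Fin n → ℕ} →
            (λ i → eval (σ i) e) ≗ e' → eval (subT σ t) e ≡ eval t e'
eval-subT σ (var i) σ≗e' = σ≗e' i
eval-subT σ zer     σ≗e' = refl
eval-subT σ (S t)   σ≗e' = cong suc (eval-subT σ t σ≗e')
eval-subT σ (s ⊕ t) σ≗e' = cong₂ _+_ (eval-subT σ s σ≗e') (eval-subT σ t σ≗e')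
eval-subT σ (s ⊗ t) σ≗e' = cong₂ _*_ (eval-subT σ s σ≗e') (eval-subT σ t σ≗e')

eval-liftS : ∀ {n m} (σ : Fin n → ATm m) {e : Fin m → ℕ} {e' : Fin n → ℕ} (k : ℕ) →
             (λ i → eval (σ i) e) ≗ e' → (λ i → eval (liftS σ i) (ext k e)) ≗ ext k e'
eval-liftS σ k σ≗e' zero    = refl
eval-liftS σ k σ≗e' (suc i) = trans (eval-renT suc (σ i) (λ _ → refl)) (σ≗e' i)

ext-cong : ∀ {n} (k : ℕ) {e e' : Fin n → ℕ} → e ≗ e' → ext k e ≗ ext k e'
ext-cong k e≗e' zero    = refl
ext-cong k e≗e' (suc i) = e≗e' i

eval-num : ∀ {n} (k : ℕ) {e : Fin n → ℕ} → eval (num k) e ≡ k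
eval-num zero    = refl
eval-num (suc k) = cong suc (eval-num k)

sat-cong : ∀ {n} (ψ : LFm n) {e e' : Fin n → ℕ} → e ≗ e' → Sat ψ e → Sat ψ e'
sat-cong (equ s t) e≗e' rewrite eval-cong s e≗e' | eval-cong t e≗e' = id
sat-cong (neq s t) e≗e' rewrite eval-cong s e≗e' | eval-cong t e≗e' = id
sat-cong (pos p t) e≗e' rewrite eval-cong t e≗e' = id
sat-cong (neg p t) e≗e' rewrite eval-cong t e≗e' = id
sat-cong (a ∨' b)  e≗e' = Sum.map (sat-cong a e≗e') (sat-cong b e≗e')
sat-cong (a ∧' b)  e≗e' = Product.map (sat-cong a e≗e') (sat-cong b e≗e')
sat-cong (ex a)    e≗e' = Product.map₂ λ {k} → sat-cong a (ext-cong k e≗e')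
sat-cong (all a)   e≗e' = λ ∀a k → sat-cong a (ext-cong k e≗e') (∀a k)

∃-cong-⇔ : ∀ {I : Set} {A B : I → Set} → (∀ i → A i ⇔ B i) → Σ I A ⇔ Σ I B
∃-cong-⇔ A⇔B = mk⇔ (λ (i , a) → i , to (A⇔B i) a) (λ (i , b) → i , from (A⇔B i) b)

∀-cong-⇔ : ∀ {I : Set} {A B : I → Set} → (∀ i → A i ⇔ B i) → ((i : I) → A i) ⇔ ((i : I) → B i)
∀-cong-⇔ A⇔B = mk⇔ (λ a i → to (A⇔B i) (a i)) (λ b i → from (A⇔B i) (b i))

sat-subF : ∀ {n m} (ψ : LFm n) (σ : Fin n → ATm m) {e : Fin m → ℕ} {e' : Fin n → ℕ} →
           (λ i → eval (σ i) e) ≗ e' → Sat (subF id id σ ψ) e ⇔ Sat ψ e'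
sat-subF (equ s t) σ σ≗e' rewrite eval-subT σ s σ≗e' | eval-subT σ t σ≗e' = ⇔-id _
sat-subF (neq s t) σ σ≗e' rewrite eval-subT σ s σ≗e' | eval-subT σ t σ≗e' = ⇔-id _
sat-subF (pos p t) σ σ≗e' rewrite eval-subT σ t σ≗e' = ⇔-id _
sat-subF (neg p t) σ σ≗e' rewrite eval-subT σ t σ≗e' = ⇔-id _
sat-subF (a ∨' b)  σ σ≗e' = sat-subF a σ σ≗e' ⊎-⇔ sat-subF b σ σ≗e'
sat-subF (a ∧' b)  σ σ≗e' = sat-subF a σ σ≗e' ×-⇔ sat-subF b σ σ≗e'
sat-subF (ex a)    σ σ≗e' = ∃-cong-⇔ λ k → sat-subF a (liftS σ) (eval-liftS σ k σ≗e')
sat-subF (all a)   σ σ≗e' = ∀-cong-⇔ λ k → sat-subF a (liftS σ) (eval-liftS σ k σ≗e')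

sat-inst-subF : ∀ {n m} (p : IP) (φ : Fm ⊤ ⊥ n) (σ : Fin n → ATm m) {e : Fin m → ℕ} {e' : Fin n → ℕ} →
                (λ i → eval (σ i) e) ≗ e' →
                Sat (subF (λ _ → p) ⊥-elim σ φ) e ⇔ SatOF (Mem (form p) (tm (lvl p))) φ e'
sat-inst-subF p (equ s t) σ σ≗e' rewrite eval-subT σ s σ≗e' | eval-subT σ t σ≗e' = ⇔-id _
sat-inst-subF p (neq s t) σ σ≗e' rewrite eval-subT σ s σ≗e' | eval-subT σ t σ≗e' = ⇔-id _
sat-inst-subF p (pos _ t) σ σ≗e' rewrite eval-subT σ t σ≗e' = ⇔-id _
sat-inst-subF p (neg () t)
sat-inst-subF p (a ∨' b)  σ σ≗e' = sat-inst-subF p a σ σ≗e' ⊎-⇔ sat-inst-subF p b σ σ≗e'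
sat-inst-subF p (a ∧' b)  σ σ≗e' = sat-inst-subF p a σ σ≗e' ×-⇔ sat-inst-subF p b σ σ≗e'
sat-inst-subF p (ex a)    σ σ≗e' = ∃-cong-⇔ λ k → sat-inst-subF p a (liftS σ) (eval-liftS σ k σ≗e')
sat-inst-subF p (all a)   σ σ≗e' = ∀-cong-⇔ λ k → sat-inst-subF p a (liftS σ) (eval-liftS σ k σ≗e')

closed : Fin 0 → ℕ
closed ()

⊨_ : Sentence → Set
⊨ ψ = Sat ψ closed

sat-inst : (φ : OpForm) (t : ATm 0) (p : IP) →
           ⊨ inst φ t p ⇔ SatOF (Mem (form p) (tm (lvl p))) φ (λ _ → eval t closed)
sat-inst φ t p = sat-inst-subF p φ (λ _ → t) (λ _ → refl)

sat-negate : ∀ {n} (ψ : LFm n) {e : Fin n → ℕ} → Sat (negate ψ) e → ¬ Sat ψ e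
sat-negate (equ s t) s≢t       s≡t       = s≢t s≡t
sat-negate (neq s t) s≡t       s≢t       = s≢t s≡t
sat-negate (pos p t) ∉I        ∈I        = ∉I ∈I
sat-negate (neg p t) ∈I        ∉I        = ∉I ∈I
sat-negate (a ∨' b)  (¬a , _)  (inj₁ a′) = sat-negate a ¬a a′
sat-negate (a ∨' b)  (_ , ¬b)  (inj₂ b′) = sat-negate b ¬b b′
sat-negate (a ∧' b)  (inj₁ ¬a) (a′ , _)  = sat-negate a ¬a a′
sat-negate (a ∧' b)  (inj₂ ¬b) (_ , b′)  = sat-negate b ¬b b′
sat-negate (ex a)    ¬a        (k , a′)  = sat-negate a (¬a k) a′
sat-negate (all a)   (k , ¬a)  a′        = sat-negate a ¬a (a′ k)

-- The absurd λ inside ⊨⋁ is a different term for each list Γ, so the empty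
-- environments have to be identified by sat-cong.
⊨⋁-∷⁻ : ∀ {ψ Γ} → ⊨⋁ (ψ ∷ Γ) → ⊨ ψ ⊎ ⊨⋁ Γ
⊨⋁-∷⁻ {ψ} (here ⊨ψ) = inj₁ (sat-cong ψ (λ ()) ⊨ψ)
⊨⋁-∷⁻ (there ⊨Γ)    = inj₂ ⊨Γ

⊨⋁-∈ : ∀ {ψ Γ} → ψ ∈ Γ → ⊨ ψ → ⊨⋁ Γ
⊨⋁-∈ {ψ} ψ∈Γ ⊨ψ = lose ψ∈Γ (sat-cong ψ (λ ()) ⊨ψ)

eval-num≗ext : ∀ {m k} → m ≡ k → (λ (_ : Fin 1) → eval (num m) closed) ≗ ext k closed
eval-num≗ext m≡k zero = trans (eval-num _) m≡k

eval-closed : (t : ATm 0) → eval t closed ≡ ev t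
eval-closed t = eval-cong t (λ ())

numeral : ℕ → Term
numeral k = term ⟨ replicate k zeroTm ⟩ (wftup (all-wf k) (desc k) (singOK k))
  where
  all-wf : ∀ k → All WF (replicate k zeroTm)
  all-wf zero    = []
  all-wf (suc k) = wf0 ∷ all-wf k

  desc : ∀ k → Desc (replicate k zeroTm)
  desc zero          = d[]
  desc (suc zero)    = d1
  desc (suc (suc k)) = d∷ eq (desc (suc k))

  singOK : ∀ k → SingOK (replicate k zeroTm)
  singOK zero          = tt
  singOK (suc zero)    = tt
  singOK (suc (suc k)) = tt

numeral≺ω : ∀ k → numeral k ≺ₜ ωT
numeral≺ω zero    = tup≺tup prefix
numeral≺ω (suc k) = tup≺tup (here (tup≺tup prefix))

≮zero : ∀ {x} → ¬ (x ≺ zeroTm)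
≮zero (tup≺tup ())

dec-conj : ∀ {P : Set} (P? : Dec P) → (if does P? then conj else disj) ≡ conj → P
dec-conj (yes p) _ = p
dec-conj (no _)  ()

dec-conj⁻ : ∀ {P : Set} (P? : Dec P) → (if does P? then disj else conj) ≡ conj → ¬ P
dec-conj⁻ (yes _) ()
dec-conj⁻ (no ¬p) _ = ¬p

sat-⋀ : (ψ : Sentence) → kind ψ ≡ conj → (∀ γ (γ≺δ : γ ≺ₜ bound ψ) → ⊨ comp ψ γ γ≺δ) → ⊨ ψ
sat-⋀ (equ s t) ψ-conj _ =
  trans (eval-closed s) (trans (dec-conj (ev s ≟ ev t) ψ-conj) (sym (eval-closed t)))
sat-⋀ (neq s t) ψ-conj _ s≡t =
  dec-conj⁻ (ev s ≟ ev t) ψ-conj (trans (sym (eval-closed s)) (trans s≡t (eval-closed t)))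
sat-⋀ (neg p t) _ ψ_γ (mem γ γ≺δ φ[t]) =
  sat-negate (inst (form p) t _) (ψ_γ γ γ≺δ) (from (sat-inst (form p) t _) φ[t])
sat-⋀ (a ∧' b) _ ψ_γ = ψ_γ zeroT (tup≺tup prefix) , ψ_γ (numeral 1) (tup≺tup (there prefix))
sat-⋀ (all a) _ ψ_γ k =
  to (sat-subF a _ (eval-num≗ext (length-replicate k))) (ψ_γ (numeral k) (numeral≺ω k))

sat-⋁ : (ψ : Sentence) → kind ψ ≡ disj → ∀ γ (γ≺δ : γ ≺ₜ bound ψ) → ⊨ comp ψ γ γ≺δ → ⊨ ψ
sat-⋁ (equ s t) _ _ γ≺0 _ = ⊥-elim (≮zero γ≺0)
sat-⋁ (neq s t) _ _ γ≺0 _ = ⊥-elim (≮zero γ≺0)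
sat-⋁ (pos p t) _ γ γ≺δ φ[t] = mem γ γ≺δ (to (sat-inst (form p) t _) φ[t])
sat-⋁ (a ∨' b) _ γ _ ψ_γ with toNat (tm γ)
... | zero  = inj₁ ψ_γ
... | suc _ = inj₂ ψ_γ
sat-⋁ (ex a) _ γ _ ψ_γ = toNat (tm γ) , to (sat-subF a _ (eval-num≗ext refl)) ψ_γ

-- Excluded middle is needed for the ⋀-rule: a premise ⋁(ψ_γ ∷ Γ) yields ψ_γ
-- only once ⋁Γ is known to fail.
sound : ExcludedMiddle 0ℓ → ∀ {H α ρ Γ} → Der H α ρ Γ → tm α ≺ Ω → ⊨⋁ Γ
sound lem (⋀-rule _ ψ ψ∈Γ ψ-conj premise) α≺Ω with lem {⊨⋁ _}
... | yes ⊨Γ = ⊨Γ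
... | no ⊭Γ  = ⊨⋁-∈ ψ∈Γ (sat-⋀ ψ ψ-conj λ γ γ≺δ →
  let (_ , α'≺α , d) = premise γ γ≺δ in
  [ id , ⊥-elim ∘ ⊭Γ ]′ (⊨⋁-∷⁻ (sound lem d (below≺ α'≺α α≺Ω))))
sound lem (⋁-rule _ ψ ψ∈Γ ψ-disj γ γ≺δ _ _ _ α'≺α d) α≺Ω with ⊨⋁-∷⁻ (sound lem d (below≺ α'≺α α≺Ω))
... | inj₁ ⊨ψ_γ = ⊨⋁-∈ ψ∈Γ (sat-⋁ ψ ψ-disj γ γ≺δ ⊨ψ_γ)
... | inj₂ ⊨Γ   = ⊨Γ
sound lem (cut _ ψ _ _ _ _ α'≺α d d¬) α≺Ω
  with ⊨⋁-∷⁻ (sound lem d (below≺ α'≺α α≺Ω)) | ⊨⋁-∷⁻ (sound lem d¬ (below≺ α'≺α α≺Ω))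
... | inj₂ ⊨Γ | _        = ⊨Γ
... | inj₁ _  | inj₂ ⊨Γ  = ⊨Γ
... | inj₁ ⊨ψ | inj₁ ⊨¬ψ = ⊥-elim (sat-negate ψ ⊨¬ψ ⊨ψ)
sound lem (fix _ Ω⪯α _ _ _ _ _ _ _) α≺Ω = ⊥-elim (noΩ Ω⪯α α≺Ω)

proposition5p8 : ExcludedMiddle 0ℓ → (H : Op) → Nice H →
    (α ρ : Term) (Γ : List Sentence) → Der H α ρ Γ → tm α ≺ Ω → ⊨⋁ Γ
proposition5p8 lem H _ α ρ Γ d α≺Ω = sound lem d α≺Ω
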